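{- For every $n\ge 5$, the cycle $C_n$ satisfies $\chi_{\mathrm{gp}}(C_n)=\left\lceil \frac{n}{3}\right\rceil$.
   Context: A set is in general position if no shortest path contains more than two of its vertices; $\chi_{\mathrm{gp}}(G)$ is the minimum number of colours in a colouring of $V(G)$ with each colour class in general position. -}

module Defs where

open import Data.Nat using (ℕ; zero; suc; _+_; _≤_; NonZero)
open import Data.Nat.DivMod using (_%_; _/_)
open import Data.Fin using (Fin; toℕ)
open import Data.Product using (Σ; _×_; _,_)
open import Data.Sum using (_⊎_)
open import Relation.Binary.PropositionalEquality using (_≡_; _≢_)
open import Relation.Nullary using (¬_)
open import Data.Empty using (⊥)

record Graph (V : Set) : Set₁ where
  field
    Adj : V → V → Set

module _ {V : Set} (G : Graph V) where
  open Graph G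

  data Walk : V → V → Set where
    [_]  : (u : V) → Walk u u
    _∷_  : ∀ {u w v} → Adj u w → Walk w v → Walk u v

  len : ∀ {u v} → Walk u v → ℕ
  len [ u ]     = 0
  len (_ ∷ p)   = suc (len p)

  data _∈W_ (x : V) : ∀ {u v} → Walk u v → Set where
    here₀ : x ∈W [ x ]
    here  : ∀ {w v} (e : Adj x w) (p : Walk w v) → x ∈W (e ∷ p)
    there : ∀ {u w v} (e : Adj u w) (p : Walk w v) → x ∈W p → x ∈W (e ∷ p)

  -- a shortest u–v path: a walk from u to v of minimum length among all u–v walks
  -- (such a walk is automatically a path, i.e. repeats no vertex)
  IsShortest : ∀ {u v} → Walk u v → Set
  IsShortest {u} {v} p = ∀ (q : Walk u v) → len p ≤ len q

  InGeneralPosition : (V → Set) → Set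
  InGeneralPosition S =
    ∀ {u v} (p : Walk u v) → IsShortest p →
    ∀ x y z → S x → S y → S z → x ≢ y → y ≢ z → x ≢ z →
    x ∈W p → y ∈W p → z ∈W p → ⊥

  IsGPColouring : (k : ℕ) → (V → Fin k) → Set
  IsGPColouring k c = ∀ (i : Fin k) → InGeneralPosition (λ x → c x ≡ i)

  GPChromaticNumberIs : ℕ → Set
  GPChromaticNumberIs m =
    Σ (V → Fin m) (IsGPColouring m) ×
    (∀ k (c : V → Fin k) → IsGPColouring k c → m ≤ k)

Cycle : (n : ℕ) → .{{_ : NonZero n}} → Graph (Fin n)
Cycle n = record { Adj = λ i j → (toℕ j ≡ (toℕ i + 1) % n) ⊎ (toℕ i ≡ (toℕ j + 1) % n) }

⌈_/3⌉ : ℕ → ℕ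
⌈ n /3⌉ = (n + 2) / 3

module Submission where

-- Let k = ⌈n/3⌉, so 2k < n ≤ 3k. Colouring x by x mod k gives colour classes {r, r + k, r + 2k}.
-- A shortest path of Cₙ has at most n/2 edges, so its vertices lie in a window of m + 1
-- consecutive vertices with 2m ≤ n. The complement of a window containing r, r + k and r + 2k
-- lies inside one of the gaps between them (of lengths k, k and n − 2k), so the window has width
-- at least n − k > n/2.
-- Conversely every vertex a is an endpoint of two shortest paths that together cover Cₙ (the two
-- halves of the cycle cut at a), so a set in general position has at most three vertices and a
-- gp-colouring needs at least n/3 colours.

open import Defs
open import Data.Nat using (ℕ; zero; suc; pred; ⌊_/2⌋; ⌈_/2⌉; _+_; _*_; _∸_; _≤_; _<_; z≤n; s≤s; z<s; NonZero; >-nonZero; >-nonZero⁻¹; s≤s⁻¹; _<?_; _≤?_)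
open import Data.Nat.Properties hiding (_≟_)
open import Data.Nat.DivMod using (_%_; _/_; _mod_; m%n<n; m<n⇒m%n≡m; [m+n]%n≡m%n; m≡m%n+[m/n]*n; m/n*n≤m; m<n*o⇒m/o<n; %-distribˡ-+; m%n%n≡m%n)
open import Data.Nat.Tactic.RingSolver using (solve-∀)
open import Data.Fin using (Fin; zero; suc; toℕ)
open import Data.Fin.Properties using (toℕ-injective; toℕ-fromℕ<; toℕ<n; _≟_)
open import Data.List using (List; []; _∷_; length; filter; applyDownFrom)
open import Data.List.Properties using (length-applyDownFrom)
open import Data.Product using (∃-syntax; _×_; _,_)
open import Data.Sum using (_⊎_; inj₁; inj₂)
open import Data.Empty using (⊥; ⊥-elim)
open import Relation.Nullary using (yes; no)
open import Relation.Binary.PropositionalEquality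

m<n+n⇒m≡m%n⊎m≡m%n+n : ∀ {m n} .{{_ : NonZero n}} → m < n + n → m ≡ m % n ⊎ m ≡ m % n + n
m<n+n⇒m≡m%n⊎m≡m%n+n {m} {n} m<2n with m <? n
... | yes m<n = inj₁ (sym (m<n⇒m%n≡m m<n))
... | no m≮n = inj₂ (begin
  m                ≡⟨ m∸n+n≡m n≤m ⟨
  m ∸ n + n        ≡⟨ cong (_+ n) (m<n⇒m%n≡m (m<n+o⇒m∸n<o m n m<2n)) ⟨
  (m ∸ n) % n + n  ≡⟨ cong (_+ n) ([m+n]%n≡m%n (m ∸ n) n) ⟨
  (m ∸ n + n) % n + n ≡⟨ cong (λ t → t % n + n) (m∸n+n≡m n≤m) ⟩
  m % n + n        ∎)
  where
    open ≡-Reasoning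
    n≤m : n ≤ m
    n≤m = ≮⇒≥ m≮n

c+a≡x⇒c+b≡x+n⇒n≤b : ∀ {a b c n x} → c + a ≡ x → c + b ≡ x + n → n ≤ b
c+a≡x⇒c+b≡x+n⇒n≤b {a} {b} {c} {n} refl c+b≡c+a+n =
  subst (n ≤_) (sym (+-cancelˡ-≡ c b (a + n) (trans c+b≡c+a+n (+-assoc c a n)))) (m≤n+m n a)

[m%d+n]%d≡[m+n]%d : ∀ m n d .{{_ : NonZero d}} → (m % d + n) % d ≡ (m + n) % d
[m%d+n]%d≡[m+n]%d m n d = begin
  (m % d + n) % d          ≡⟨ %-distribˡ-+ (m % d) n d ⟩
  (m % d % d + n % d) % d  ≡⟨ cong (λ t → (t + n % d) % d) (m%n%n≡m%n m d) ⟩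
  (m % d + n % d) % d      ≡⟨ %-distribˡ-+ m n d ⟨
  (m + n) % d              ∎
  where open ≡-Reasoning

[m+n%d]%d≡[m+n]%d : ∀ m n d .{{_ : NonZero d}} → (m + n % d) % d ≡ (m + n) % d
[m+n%d]%d≡[m+n]%d m n d = begin
  (m + n % d) % d  ≡⟨ cong (_% d) (+-comm m (n % d)) ⟩
  (n % d + m) % d  ≡⟨ [m%d+n]%d≡[m+n]%d n m d ⟩
  (n + m) % d      ≡⟨ cong (_% d) (+-comm n m) ⟩
  (m + n) % d      ∎
  where open ≡-Reasoning

mod-injective-< : ∀ {n j j′} .{{_ : NonZero n}} → j′ < j → j < n → j mod n ≢ j′ mod n
mod-injective-< {n} {j} {j′} j′<j j<n eq = <-irrefl (begin
  j′                  ≡⟨ m<n⇒m%n≡m (<-trans j′<j j<n) ⟨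
  j′ % n              ≡⟨ toℕ-fromℕ< (m%n<n j′ n) ⟨
  toℕ (j′ mod n)      ≡⟨ cong toℕ eq ⟨
  toℕ (j mod n)       ≡⟨ toℕ-fromℕ< (m%n<n j n) ⟩
  j % n               ≡⟨ m<n⇒m%n≡m j<n ⟩
  j                   ∎) j′<j
  where open ≡-Reasoning

m+m≤n⇒m<n : ∀ {m n} .{{_ : NonZero n}} → m + m ≤ n → m < n
m+m≤n⇒m<n {zero}  {n} _     = >-nonZero⁻¹ n
m+m≤n⇒m<n {suc m}     m+m≤n = <-≤-trans (m<m+n (suc m) z<s) m+m≤n

halves : ∀ n .{{_ : NonZero n}} → ∃[ h₁ ] ∃[ h₂ ] suc (h₁ + h₂) ≡ n × h₁ + h₁ ≤ n × h₂ + h₂ ≤ n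
halves (suc n) = ⌈ n /2⌉ , ⌊ n /2⌋ , cong suc ⌈⌉+⌊⌋≡n , ⌈⌉+⌈⌉≤1+n , ⌊⌋+⌊⌋≤1+n
  where
    open ≤-Reasoning
    ⌈⌉+⌊⌋≡n : ⌈ n /2⌉ + ⌊ n /2⌋ ≡ n
    ⌈⌉+⌊⌋≡n = trans (+-comm ⌈ n /2⌉ ⌊ n /2⌋) (⌊n/2⌋+⌈n/2⌉≡n n)
    ⌈⌉+⌈⌉≤1+n : ⌈ n /2⌉ + ⌈ n /2⌉ ≤ suc n
    ⌈⌉+⌈⌉≤1+n = begin
      ⌈ n /2⌉ + ⌈ n /2⌉        ≤⟨ +-monoʳ-≤ ⌈ n /2⌉ (⌊n/2⌋-mono (n≤1+n (suc n))) ⟩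
      ⌈ n /2⌉ + suc ⌊ n /2⌋    ≡⟨ +-suc ⌈ n /2⌉ ⌊ n /2⌋ ⟩
      suc (⌈ n /2⌉ + ⌊ n /2⌋)  ≡⟨ cong suc ⌈⌉+⌊⌋≡n ⟩
      suc n                    ∎
    ⌊⌋+⌊⌋≤1+n : ⌊ n /2⌋ + ⌊ n /2⌋ ≤ suc n
    ⌊⌋+⌊⌋≤1+n = begin
      ⌊ n /2⌋ + ⌊ n /2⌋  ≤⟨ +-monoʳ-≤ ⌊ n /2⌋ (⌊n/2⌋≤⌈n/2⌉ n) ⟩
      ⌊ n /2⌋ + ⌈ n /2⌉  ≡⟨ ⌊n/2⌋+⌈n/2⌉≡n n ⟩
      n                  ≤⟨ n≤1+n n ⟩
      suc n              ∎

n≤⌈n/3⌉*3 : ∀ n → n ≤ ⌈ n /3⌉ * 3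
n≤⌈n/3⌉*3 n = +-cancelʳ-≤ 2 n _ (begin
  n + 2                      ≡⟨ m≡m%n+[m/n]*n (n + 2) 3 ⟩
  (n + 2) % 3 + ⌈ n /3⌉ * 3  ≤⟨ +-monoˡ-≤ _ (s≤s⁻¹ (m%n<n (n + 2) 3)) ⟩
  2 + ⌈ n /3⌉ * 3            ≡⟨ +-comm 2 _ ⟩
  ⌈ n /3⌉ * 3 + 2            ∎)
  where open ≤-Reasoning

⌈n/3⌉-least : ∀ {n} k → n ≤ k * 3 → ⌈ n /3⌉ ≤ k
⌈n/3⌉-least {n} k n≤k*3 = s≤s⁻¹ (m<n*o⇒m/o<n (begin-strict
  n + 2      <⟨ +-monoʳ-< n (n<1+n 2) ⟩
  n + 3      ≤⟨ +-monoˡ-≤ 3 n≤k*3 ⟩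
  k * 3 + 3  ≡⟨ +-comm (k * 3) 3 ⟩
  suc k * 3  ∎))
  where open ≤-Reasoning

⌈n/3⌉-nonZero : ∀ {n} → .{{NonZero n}} → NonZero ⌈ n /3⌉
⌈n/3⌉-nonZero {n} = >-nonZero (*-cancelʳ-< 3 0 ⌈ n /3⌉ (<-≤-trans (>-nonZero⁻¹ n) (n≤⌈n/3⌉*3 n)))

⌈n/3⌉+⌈n/3⌉<n : ∀ {n} → 5 ≤ n → ⌈ n /3⌉ + ⌈ n /3⌉ < n
⌈n/3⌉+⌈n/3⌉<n {n} 5≤n = ≰⇒> λ n≤k+k → <⇒≱ 5≤n (+-cancelˡ-≤ (n + n) n 4 (begin
  n + n + n                  ≤⟨ +-mono-≤ (+-mono-≤ n≤k+k n≤k+k) n≤k+k ⟩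
  (k + k) + (k + k) + (k + k) ≡⟨ six k ⟩
  k * 3 + k * 3              ≤⟨ +-mono-≤ k*3≤n+2 k*3≤n+2 ⟩
  (n + 2) + (n + 2)          ≡⟨ regroup n ⟩
  n + n + 4                  ∎))
  where
    open ≤-Reasoning
    k : ℕ
    k = ⌈ n /3⌉
    k*3≤n+2 : k * 3 ≤ n + 2
    k*3≤n+2 = m/n*n≤m (n + 2) 3
    six : ∀ k → (k + k) + (k + k) + (k + k) ≡ k * 3 + k * 3
    six = solve-∀
    regroup : ∀ n → (n + 2) + (n + 2) ≡ n + n + 4
    regroup = solve-∀

threeDistinct<3⇒012 : ∀ {a b c} → a < 3 → b < 3 → c < 3 → a ≢ b → b ≢ c → a ≢ c →
                      ∀ {P : ℕ → Set} → P a → P b → P c → P 0 × P 1 × P 2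
threeDistinct<3⇒012 {0} {1} {2} _ _ _ _ _ _ pa pb pc = pa , pb , pc
threeDistinct<3⇒012 {0} {2} {1} _ _ _ _ _ _ pa pb pc = pa , pc , pb
threeDistinct<3⇒012 {1} {0} {2} _ _ _ _ _ _ pa pb pc = pb , pa , pc
threeDistinct<3⇒012 {1} {2} {0} _ _ _ _ _ _ pa pb pc = pc , pa , pb
threeDistinct<3⇒012 {2} {0} {1} _ _ _ _ _ _ pa pb pc = pb , pc , pa
threeDistinct<3⇒012 {2} {1} {0} _ _ _ _ _ _ pa pb pc = pc , pb , pa
threeDistinct<3⇒012 {0} {0} _ _ _ a≢b _ _ = ⊥-elim (a≢b refl)
threeDistinct<3⇒012 {1} {1} _ _ _ a≢b _ _ = ⊥-elim (a≢b refl)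
threeDistinct<3⇒012 {2} {2} _ _ _ a≢b _ _ = ⊥-elim (a≢b refl)
threeDistinct<3⇒012 {b = 0} {0} _ _ _ _ b≢c _ = ⊥-elim (b≢c refl)
threeDistinct<3⇒012 {b = 1} {1} _ _ _ _ b≢c _ = ⊥-elim (b≢c refl)
threeDistinct<3⇒012 {b = 2} {2} _ _ _ _ b≢c _ = ⊥-elim (b≢c refl)
threeDistinct<3⇒012 {0} {c = 0} _ _ _ _ _ a≢c = ⊥-elim (a≢c refl)
threeDistinct<3⇒012 {1} {c = 1} _ _ _ _ _ a≢c = ⊥-elim (a≢c refl)
threeDistinct<3⇒012 {2} {c = 2} _ _ _ _ _ a≢c = ⊥-elim (a≢c refl)
threeDistinct<3⇒012 {suc (suc (suc _))} (s≤s (s≤s (s≤s ()))) _ _ _ _ _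
threeDistinct<3⇒012 {b = suc (suc (suc _))} _ (s≤s (s≤s (s≤s ()))) _ _ _ _
threeDistinct<3⇒012 {c = suc (suc (suc _))} _ _ (s≤s (s≤s (s≤s ()))) _ _ _

module Lifts {n k m : ℕ} (m+m≤n : m + m ≤ n) (k+k<n : k + k < n) (n≤k*3 : n ≤ k * 3) where

  InWindow : ℕ → ℕ → Set
  InWindow A ℓ = A ≤ ℓ × ℓ ≤ A + m

  -- ℓ is a position on ℕ of the cycle vertex r + q * k, either directly or after one full turn.
  LiftOf : ℕ → ℕ → ℕ → Set
  LiftOf r q ℓ = ℓ ≡ r + q * k ⊎ ℓ ≡ r + q * k + n

  Occupied : ℕ → ℕ → ℕ → Set
  Occupied A r q = ∃[ ℓ ] InWindow A ℓ × LiftOf r q ℓ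

  -- The equation says ℓ − ℓ′ ≥ n − k, stated without subtraction; a window of width m ≤ n/2 < n − k is narrower.
  window-narrow : ∀ {A ℓ ℓ′} d → InWindow A ℓ → InWindow A ℓ′ → ℓ′ + d ≡ ℓ + k → n ≤ d → ⊥
  window-narrow {A} {ℓ} {ℓ′} d (_ , ℓ≤A+m) (A≤ℓ′ , _) eq n≤d = <-irrefl refl (begin-strict
    n + n              ≤⟨ +-mono-≤ n≤m+k n≤m+k ⟩
    (m + k) + (m + k)  ≡⟨ +-comm-middle m k m k ⟩
    (m + m) + (k + k)  <⟨ +-mono-≤-< m+m≤n k+k<n ⟩
    n + n              ∎)
    where
      open ≤-Reasoning
      +-comm-middle : ∀ a b c d → (a + b) + (c + d) ≡ (a + c) + (b + d)
      +-comm-middle = solve-∀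
      n≤m+k : n ≤ m + k
      n≤m+k = +-cancelˡ-≤ ℓ′ n (m + k) (begin
        ℓ′ + n        ≤⟨ +-monoʳ-≤ ℓ′ n≤d ⟩
        ℓ′ + d        ≡⟨ eq ⟩
        ℓ + k         ≤⟨ +-monoˡ-≤ k ℓ≤A+m ⟩
        A + m + k     ≤⟨ +-monoˡ-≤ k (+-monoˡ-≤ m A≤ℓ′) ⟩
        ℓ′ + m + k    ≡⟨ +-assoc ℓ′ m k ⟩
        ℓ′ + (m + k)  ∎)

  -- The lifts lie among r + {0, k, 2k, n, n + k, n + 2k}; in every combination two of them are
  -- at least n − k apart.
  noThreeOccupied : ∀ {A r} → Occupied A r 0 → Occupied A r 1 → Occupied A r 2 → ⊥
  noThreeOccupied {r = r} (_ , w₀ , inj₁ refl) (_ , w₁ , inj₁ refl) (_ , w₂ , inj₁ refl) =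
    window-narrow (k * 3) w₂ w₀ (gap r k) n≤k*3
    where gap : ∀ r k → r + 0 * k + k * 3 ≡ r + 2 * k + k
          gap = solve-∀
  noThreeOccupied {r = r} (_ , w₀ , inj₂ refl) (_ , w₁ , inj₂ refl) (_ , w₂ , inj₂ refl) =
    window-narrow (k * 3) w₂ w₀ (gap r k n) n≤k*3
    where gap : ∀ r k n → r + 0 * k + n + k * 3 ≡ r + 2 * k + n + k
          gap = solve-∀
  noThreeOccupied {r = r} (_ , w₀ , inj₁ refl) (_ , w₁ , inj₂ refl) _ =
    window-narrow (n + k + k) w₁ w₀ (gap r k n) (≤-trans (m≤m+n n k) (m≤m+n (n + k) k))
    where gap : ∀ r k n → r + 0 * k + (n + k + k) ≡ r + 1 * k + n + k
          gap = solve-∀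
  noThreeOccupied {r = r} (_ , w₀ , inj₂ refl) (_ , w₁ , inj₁ refl) _ =
    window-narrow n w₀ w₁ (gap r k n) ≤-refl
    where gap : ∀ r k n → r + 1 * k + n ≡ r + 0 * k + n + k
          gap = solve-∀
  noThreeOccupied {r = r} (_ , w₀ , inj₁ refl) (_ , w₁ , inj₁ refl) (_ , w₂ , inj₂ refl) =
    window-narrow (n + k * 3) w₂ w₀ (gap r k n) (m≤m+n n (k * 3))
    where gap : ∀ r k n → r + 0 * k + (n + k * 3) ≡ r + 2 * k + n + k
          gap = solve-∀
  noThreeOccupied {r = r} (_ , w₀ , inj₂ refl) (_ , w₁ , inj₂ refl) (_ , w₂ , inj₁ refl) =
    window-narrow n w₁ w₂ (gap r k n) ≤-refl
    where gap : ∀ r k n → r + 2 * k + n ≡ r + 1 * k + n + k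
          gap = solve-∀

AtMostThree : {A : Set} → (A → Set) → Set
AtMostThree S = ∀ a b c d → S a → S b → S c → S d →
                a ≢ b → a ≢ c → a ≢ d → b ≢ c → b ≢ d → c ≢ d → ⊥

count : ∀ {k} → Fin k → List (Fin k) → ℕ
count i xs = length (filter (_≟ i) xs)

lastOccurrence : ∀ {k} (f : ℕ → Fin k) i m r → suc r ≤ count i (applyDownFrom f m) →
                 ∃[ j ] j < m × f j ≡ i × r ≤ count i (applyDownFrom f j)
lastOccurrence f i (suc m) r r<count with f m ≟ i
... | yes fm≡i = m , ≤-refl , fm≡i , s≤s⁻¹ r<count
... | no _ with lastOccurrence f i m r r<count
...   | j , j<m , fj≡i , r≤count = j , m<n⇒m<1+n j<m , fj≡i , r≤count

dropZeros : ∀ {k} → List (Fin (suc k)) → List (Fin k)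
dropZeros []           = []
dropZeros (zero ∷ xs)  = dropZeros xs
dropZeros (suc i ∷ xs) = i ∷ dropZeros xs

length-dropZeros : ∀ {k} (xs : List (Fin (suc k))) → length xs ≡ count zero xs + length (dropZeros xs)
length-dropZeros []           = refl
length-dropZeros (zero ∷ xs)  = cong suc (length-dropZeros xs)
length-dropZeros (suc i ∷ xs) = trans (cong suc (length-dropZeros xs)) (sym (+-suc (count zero xs) _))

count-dropZeros : ∀ {k} (i : Fin k) xs → count i (dropZeros xs) ≡ count (suc i) xs
count-dropZeros i []           = refl
count-dropZeros i (zero ∷ xs)  = count-dropZeros i xs
count-dropZeros i (suc j ∷ xs) with j ≟ i
... | yes _ = cong suc (count-dropZeros i xs)
... | no _  = count-dropZeros i xs

length≤k*b : ∀ {b} k (xs : List (Fin k)) → (∀ i → count i xs ≤ b) → length xs ≤ k * b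
length≤k*b zero [] _ = z≤n
length≤k*b {b} (suc k) xs count≤b = begin
  length xs                               ≡⟨ length-dropZeros xs ⟩
  count zero xs + length (dropZeros xs)   ≤⟨ +-mono-≤ (count≤b zero) (length≤k*b k (dropZeros xs) count-dropZeros≤b) ⟩
  b + k * b                               ∎
  where
    open ≤-Reasoning
    count-dropZeros≤b : ∀ i → count i (dropZeros xs) ≤ b
    count-dropZeros≤b i = ≤-trans (≤-reflexive (count-dropZeros i xs)) (count≤b (suc i))

fibres≤3⇒n≤k*3 : ∀ n {k} (c : Fin n → Fin k) → (∀ i → AtMostThree (λ x → c x ≡ i)) → n ≤ k * 3
fibres≤3⇒n≤k*3 zero          _ _       = z≤n
fibres≤3⇒n≤k*3 n@(suc _) {k} c atMost3 =
  subst (_≤ k * 3) (length-applyDownFrom colour n) (length≤k*b k (applyDownFrom colour n) count≤3)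
  where
    colour : ℕ → Fin k
    colour j = c (j mod n)
    count≤3 : ∀ i → count i (applyDownFrom colour n) ≤ 3
    count≤3 i with count i (applyDownFrom colour n) ≤? 3
    ... | yes ≤3 = ≤3
    ... | no count≰3
      with j₁ , j₁<n  , c₁ , more₁ ← lastOccurrence colour i n  3 (≰⇒> count≰3)
      with j₂ , j₂<j₁ , c₂ , more₂ ← lastOccurrence colour i j₁ 2 more₁
      with j₃ , j₃<j₂ , c₃ , more₃ ← lastOccurrence colour i j₂ 1 more₂
      with j₄ , j₄<j₃ , c₄ , _     ← lastOccurrence colour i j₃ 0 more₃
      = ⊥-elim (atMost3 i _ _ _ _ c₁ c₂ c₃ c₄
          (mod-injective-< j₂<j₁ j₁<n) (mod-injective-< j₃<j₁ j₁<n) (mod-injective-< j₄<j₁ j₁<n)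
          (mod-injective-< j₃<j₂ j₂<n) (mod-injective-< j₄<j₂ j₂<n) (mod-injective-< j₄<j₃ j₃<n))
      where
        j₂<n : j₂ < n
        j₂<n = <-trans j₂<j₁ j₁<n
        j₃<n : j₃ < n
        j₃<n = <-trans j₃<j₂ j₂<n
        j₃<j₁ : j₃ < j₁
        j₃<j₁ = <-trans j₃<j₂ j₂<j₁
        j₄<j₂ : j₄ < j₂
        j₄<j₂ = <-trans j₄<j₃ j₃<j₂
        j₄<j₁ : j₄ < j₁
        j₄<j₁ = <-trans j₄<j₂ j₂<j₁

module _ {V : Set} (G : Graph V) where
  open Graph G

  start∈ : ∀ {u v} (p : Walk G u v) → _∈W_ G u p
  start∈ [ u ]   = here₀
  start∈ (e ∷ p) = here e p

  end∈ : ∀ {u v} (p : Walk G u v) → _∈W_ G v p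
  end∈ [ u ]   = here₀
  end∈ (e ∷ p) = there e p (end∈ p)

  module _ (Adj-sym : ∀ {x y} → Adj x y → Adj y x) where

    reverseOnto : ∀ {x y z} → Walk G x y → Walk G x z → Walk G y z
    reverseOnto [ _ ]   acc = acc
    reverseOnto (e ∷ p) acc = reverseOnto p (Adj-sym e ∷ acc)

    len-reverseOnto : ∀ {x y z} (p : Walk G x y) (acc : Walk G x z) →
                      len G (reverseOnto p acc) ≡ len G p + len G acc
    len-reverseOnto [ _ ]   acc = refl
    len-reverseOnto (e ∷ p) acc = trans (len-reverseOnto p (Adj-sym e ∷ acc)) (+-suc (len G p) (len G acc))

    reverse : ∀ {u v} → Walk G u v → Walk G v u
    reverse {u} p = reverseOnto p [ u ]

    len-reverse : ∀ {u v} (p : Walk G u v) → len G (reverse p) ≡ len G p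
    len-reverse {u} p = trans (len-reverseOnto p [ u ]) (+-identityʳ (len G p))

  record GeodesicCover (a : V) : Set where
    field
      {s₁ t₁ s₂ t₂} : V
      path₁     : Walk G s₁ t₁
      path₂     : Walk G s₂ t₂
      shortest₁ : IsShortest G path₁
      shortest₂ : IsShortest G path₂
      a∈path₁   : _∈W_ G a path₁
      a∈path₂   : _∈W_ G a path₂
      covers    : ∀ x → _∈W_ G x path₁ ⊎ _∈W_ G x path₂

  geodesicCovers⇒AtMostThree : (∀ a → GeodesicCover a) → ∀ {S} → InGeneralPosition G S → AtMostThree S
  geodesicCovers⇒AtMostThree cover gp a b c d Sa Sb Sc Sd a≢b a≢c a≢d b≢c b≢d c≢d =
    twoOnOnePath (covers b) (covers c) (covers d)
    where
      open GeodesicCover (cover a)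
      twoOnOnePath : _∈W_ G b path₁ ⊎ _∈W_ G b path₂ → _∈W_ G c path₁ ⊎ _∈W_ G c path₂ →
                     _∈W_ G d path₁ ⊎ _∈W_ G d path₂ → ⊥
      twoOnOnePath (inj₁ b∈) (inj₁ c∈) _         = gp path₁ shortest₁ a b c Sa Sb Sc a≢b b≢c a≢c a∈path₁ b∈ c∈
      twoOnOnePath (inj₂ b∈) (inj₂ c∈) _         = gp path₂ shortest₂ a b c Sa Sb Sc a≢b b≢c a≢c a∈path₂ b∈ c∈
      twoOnOnePath (inj₁ b∈) (inj₂ _)  (inj₁ d∈) = gp path₁ shortest₁ a b d Sa Sb Sd a≢b b≢d a≢d a∈path₁ b∈ d∈
      twoOnOnePath (inj₂ b∈) (inj₁ _)  (inj₂ d∈) = gp path₂ shortest₂ a b d Sa Sb Sd a≢b b≢d a≢d a∈path₂ b∈ d∈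
      twoOnOnePath (inj₁ _)  (inj₂ c∈) (inj₂ d∈) = gp path₂ shortest₂ a c d Sa Sc Sd a≢c c≢d a≢d a∈path₂ c∈ d∈
      twoOnOnePath (inj₂ _)  (inj₁ c∈) (inj₁ d∈) = gp path₁ shortest₁ a c d Sa Sc Sd a≢c c≢d a≢d a∈path₁ c∈ d∈

module CycleGeometry (n : ℕ) .{{_ : NonZero n}} where

  Cₙ : Graph (Fin n)
  Cₙ = Cycle n

  open Graph Cₙ

  _∈_ : Fin n → ∀ {u v} → Walk Cₙ u v → Set
  x ∈ p = _∈W_ Cₙ x p

  next : Fin n → Fin n
  next u = (toℕ u + 1) mod n

  infixl 6 _⊕_
  infix  4 _∈_

  -- Iterating next from the front makes arc u (suc h) definitionally an edge followed by arc (next u) h.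
  _⊕_ : Fin n → ℕ → Fin n
  u ⊕ zero  = u
  u ⊕ suc t = next u ⊕ t

  toℕ-next : ∀ u → toℕ (next u) ≡ (toℕ u + 1) % n
  toℕ-next u = toℕ-fromℕ< (m%n<n (toℕ u + 1) n)

  Adj-next : ∀ u → Adj u (next u)
  Adj-next u = inj₁ (toℕ-next u)

  Adj-sym : ∀ {u w} → Adj u w → Adj w u
  Adj-sym (inj₁ e) = inj₂ e
  Adj-sym (inj₂ e) = inj₁ e

  Adj⇒next : ∀ {u w} → Adj u w → w ≡ next u ⊎ u ≡ next w
  Adj⇒next {u} {w} (inj₁ e) = inj₁ (toℕ-injective (trans e (sym (toℕ-next u))))
  Adj⇒next {u} {w} (inj₂ e) = inj₂ (toℕ-injective (trans e (sym (toℕ-next w))))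

  toℕ-⊕ : ∀ u t → toℕ (u ⊕ t) ≡ (toℕ u + t) % n
  toℕ-⊕ u zero    = sym (trans (cong (_% n) (+-identityʳ (toℕ u))) (m<n⇒m%n≡m (toℕ<n u)))
  toℕ-⊕ u (suc t) = begin
    toℕ (next u ⊕ t)           ≡⟨ toℕ-⊕ (next u) t ⟩
    (toℕ (next u) + t) % n     ≡⟨ cong (λ x → (x + t) % n) (toℕ-next u) ⟩
    ((toℕ u + 1) % n + t) % n  ≡⟨ [m%d+n]%d≡[m+n]%d (toℕ u + 1) t n ⟩
    (toℕ u + 1 + t) % n        ≡⟨ cong (_% n) (+-assoc (toℕ u) 1 t) ⟩
    (toℕ u + suc t) % n        ∎
    where open ≡-Reasoning

  ⊕-+ : ∀ u s t → u ⊕ (s + t) ≡ (u ⊕ s) ⊕ t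
  ⊕-+ u zero    t = refl
  ⊕-+ u (suc s) t = ⊕-+ (next u) s t

  ⊕-suc : ∀ u t → u ⊕ suc t ≡ next (u ⊕ t)
  ⊕-suc u zero    = refl
  ⊕-suc u (suc t) = ⊕-suc (next u) t

  ⊕-n : ∀ u → u ⊕ n ≡ u
  ⊕-n u = toℕ-injective (begin
    toℕ (u ⊕ n)      ≡⟨ toℕ-⊕ u n ⟩
    (toℕ u + n) % n  ≡⟨ [m+n]%n≡m%n (toℕ u) n ⟩
    toℕ u % n        ≡⟨ m<n⇒m%n≡m (toℕ<n u) ⟩
    toℕ u            ∎)
    where open ≡-Reasoning

  ⊕-∸ : ∀ a {s t} → s ≤ t → a ⊕ t ≡ a ⊕ s ⊕ (t ∸ s)
  ⊕-∸ a {s} {t} s≤t = trans (cong (a ⊕_) (sym (m+[n∸m]≡n s≤t))) (⊕-+ a s (t ∸ s))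

  next-injective : ∀ {u w} → next u ≡ next w → u ≡ w
  next-injective {u} {w} eq = begin
    u                 ≡⟨ ⊕-n u ⟨
    u ⊕ n             ≡⟨ cong (u ⊕_) (suc-pred n) ⟨
    next u ⊕ pred n   ≡⟨ cong (_⊕ pred n) eq ⟩
    next w ⊕ pred n   ≡⟨ cong (w ⊕_) (suc-pred n) ⟩
    w ⊕ n             ≡⟨ ⊕-n w ⟩
    w                 ∎
    where open ≡-Reasoning

  lift-⊕ : ∀ u {s} → s < n → toℕ u + s ≡ toℕ (u ⊕ s) ⊎ toℕ u + s ≡ toℕ (u ⊕ s) + n
  lift-⊕ u {s} s<n rewrite toℕ-⊕ u s = m<n+n⇒m≡m%n⊎m≡m%n+n (+-mono-< (toℕ<n u) s<n)

  ⊕-injective : ∀ u {s t} → s < n → t < n → u ⊕ s ≡ u ⊕ t → s ≡ t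
  ⊕-injective u {s} {t} s<n t<n eq with lift-⊕ u s<n | lift-⊕ u t<n
  ... | inj₁ ls | inj₁ lt = +-cancelˡ-≡ (toℕ u) s t (trans ls (trans (cong toℕ eq) (sym lt)))
  ... | inj₂ ls | inj₂ lt = +-cancelˡ-≡ (toℕ u) s t (trans ls (trans (cong (λ x → toℕ x + n) eq) (sym lt)))
  ... | inj₁ ls | inj₂ lt = ⊥-elim (<⇒≱ t<n (c+a≡x⇒c+b≡x+n⇒n≤b ls (trans lt (cong (λ x → toℕ x + n) (sym eq)))))
  ... | inj₂ ls | inj₁ lt = ⊥-elim (<⇒≱ s<n (c+a≡x⇒c+b≡x+n⇒n≤b lt (trans ls (cong (λ x → toℕ x + n) eq))))

  offset : ∀ u v → ∃[ t ] t < n × v ≡ u ⊕ t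
  offset u v = t , m%n<n _ n , toℕ-injective (sym (begin
    toℕ (u ⊕ t)                                  ≡⟨ toℕ-⊕ u t ⟩
    (toℕ u + t) % n                              ≡⟨ [m+n%d]%d≡[m+n]%d (toℕ u) _ n ⟩
    (toℕ u + (toℕ v + (n ∸ toℕ u))) % n          ≡⟨ cong (_% n) (+-comm-middle (toℕ u) (toℕ v) (n ∸ toℕ u)) ⟩
    (toℕ v + (toℕ u + (n ∸ toℕ u))) % n          ≡⟨ cong (λ x → (toℕ v + x) % n) (m+[n∸m]≡n (<⇒≤ (toℕ<n u))) ⟩
    (toℕ v + n) % n                              ≡⟨ [m+n]%n≡m%n (toℕ v) n ⟩
    toℕ v % n                                    ≡⟨ m<n⇒m%n≡m (toℕ<n v) ⟩
    toℕ v                                        ∎))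
    where
      open ≡-Reasoning
      t : ℕ
      t = (toℕ v + (n ∸ toℕ u)) % n
      +-comm-middle : ∀ a b c → a + (b + c) ≡ b + (a + c)
      +-comm-middle = solve-∀

  arc : ∀ u h → Walk Cₙ u (u ⊕ h)
  arc u zero    = [ u ]
  arc u (suc h) = Adj-next u ∷ arc (next u) h

  len-arc : ∀ u h → len Cₙ (arc u h) ≡ h
  len-arc u zero    = refl
  len-arc u (suc h) = cong suc (len-arc (next u) h)

  ∈-arc : ∀ u {h s} → s ≤ h → u ⊕ s ∈ arc u h
  ∈-arc u {zero}  z≤n       = here₀
  ∈-arc u {suc h} z≤n       = here (Adj-next u) (arc (next u) h)
  ∈-arc u {suc h} (s≤s s≤h) = there (Adj-next u) (arc (next u) h) (∈-arc (next u) s≤h)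

  Window : ∀ {u v} → Walk Cₙ u v → Fin n → ℕ → Set
  Window p a m = ∀ x → x ∈ p → ∃[ s ] s ≤ m × x ≡ a ⊕ s

  walk-window : ∀ {u v} (p : Walk Cₙ u v) → ∃[ a ] ∃[ m ] m ≤ len Cₙ p × Window p a m
  walk-window [ u ] = u , 0 , z≤n , λ { x here₀ → 0 , z≤n , refl }
  walk-window {u} (_∷_ {w = w} e q) with walk-window q
  ... | a , m , m≤len , window with window w (start∈ Cₙ q) | Adj⇒next e
  ... | sw , sw≤m , w≡a⊕sw | inj₂ u≡next-w = a , suc m , s≤s m≤len , extended
    where
      extended : Window (e ∷ q) a (suc m)
      extended _ (here _ _)      = suc sw , s≤s sw≤m , trans u≡next-w (trans (cong next w≡a⊕sw) (sym (⊕-suc a sw)))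
      extended x (there _ _ x∈q) with s , s≤m , x≡ ← window x x∈q = s , m≤n⇒m≤1+n s≤m , x≡
  ... | zero , _ , w≡a | inj₁ w≡next-u = u , suc m , s≤s m≤len , shifted
    where
      shifted : Window (e ∷ q) u (suc m)
      shifted _ (here _ _)      = 0 , z≤n , refl
      shifted x (there _ _ x∈q) with s , s≤m , x≡ ← window x x∈q =
        suc s , s≤s s≤m , trans x≡ (cong (_⊕ s) (trans (sym w≡a) w≡next-u))
  ... | suc s′ , s′<m , w≡a⊕1+s′ | inj₁ w≡next-u = a , m , m≤n⇒m≤1+n m≤len , unchanged
    where
      unchanged : Window (e ∷ q) a m
      unchanged _ (here _ _)      =
        s′ , <⇒≤ s′<m , next-injective (trans (sym w≡next-u) (trans w≡a⊕1+s′ (⊕-suc a s′)))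
      unchanged x (there _ _ x∈q) = window x x∈q

  reach : ∀ {u v} (q : Walk Cₙ u v) → ∃[ t ] t ≤ len Cₙ q × (v ≡ u ⊕ t ⊎ u ≡ v ⊕ t)
  reach q with a , m , m≤len , window ← walk-window q
          with s₁ , s₁≤m , u≡a⊕s₁ ← window _ (start∈ Cₙ q)
          with s₂ , s₂≤m , v≡a⊕s₂ ← window _ (end∈ Cₙ q)
          with ≤-total s₁ s₂
  ... | inj₁ s₁≤s₂ = s₂ ∸ s₁ , ≤-trans (m∸n≤m s₂ s₁) (≤-trans s₂≤m m≤len) ,
                     inj₁ (trans v≡a⊕s₂ (trans (⊕-∸ a s₁≤s₂) (cong (_⊕ (s₂ ∸ s₁)) (sym u≡a⊕s₁))))
  ... | inj₂ s₂≤s₁ = s₁ ∸ s₂ , ≤-trans (m∸n≤m s₁ s₂) (≤-trans s₁≤m m≤len) ,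
                     inj₂ (trans u≡a⊕s₁ (trans (⊕-∸ a s₂≤s₁) (cong (_⊕ (s₁ ∸ s₂)) (sym v≡a⊕s₂))))

  arc-shortest : ∀ u h → h + h ≤ n → IsShortest Cₙ (arc u h)
  arc-shortest u h h+h≤n q with t , t≤len , ends ← reach q
    rewrite len-arc u h = ≤-trans (≮⇒≥ (λ t<h → noShortcut t<h ends)) t≤len
    where
      noShortcut : ∀ {t} → t < h → u ⊕ h ≡ u ⊕ t ⊎ u ≡ u ⊕ h ⊕ t → ⊥
      noShortcut {t} t<h = λ
        { (inj₁ u⊕h≡u⊕t)   → <-irrefl (sym (⊕-injective u h<n t<n u⊕h≡u⊕t)) t<h
        ; (inj₂ u≡u⊕h⊕t) → <-irrefl (⊕-injective u (>-nonZero⁻¹ n) h+t<n (trans u≡u⊕h⊕t (sym (⊕-+ u h t))))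
                                       (<-≤-trans 0<h (m≤m+n h t))
        }
        where
          0<h : 0 < h
          0<h = ≤-<-trans z≤n t<h
          h<n : h < n
          h<n = <-≤-trans (m<m+n h 0<h) h+h≤n
          t<n : t < n
          t<n = <-trans t<h h<n
          h+t<n : h + t < n
          h+t<n = <-≤-trans (+-monoʳ-< h t<h) h+h≤n

  shortest-length : ∀ {u v} (p : Walk Cₙ u v) → IsShortest Cₙ p → len Cₙ p + len Cₙ p ≤ n
  shortest-length {u} {v} p shortest with t , t<n , refl ← offset u v = begin
    len Cₙ p + len Cₙ p  ≤⟨ +-mono-≤ forwards backwards ⟩
    t + (n ∸ t)                        ≡⟨ m+[n∸m]≡n (<⇒≤ t<n) ⟩
    n                                  ∎
    where
      open ≤-Reasoning
      shorterThan : ∀ {w} → w ≡ u → (q : Walk Cₙ w (u ⊕ t)) → len Cₙ p ≤ len Cₙ q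
      shorterThan refl q = shortest q
      forwards : len Cₙ p ≤ t
      forwards = subst (len Cₙ p ≤_) (len-arc u t) (shortest (arc u t))
      around : u ⊕ t ⊕ (n ∸ t) ≡ u
      around = trans (sym (⊕-+ u t (n ∸ t))) (trans (cong (u ⊕_) (m+[n∸m]≡n (<⇒≤ t<n))) (⊕-n u))
      backwards : len Cₙ p ≤ n ∸ t
      backwards = subst (len Cₙ p ≤_) (trans (len-reverse Cₙ Adj-sym (arc (u ⊕ t) (n ∸ t))) (len-arc (u ⊕ t) (n ∸ t)))
                    (shorterThan around (reverse Cₙ Adj-sym (arc (u ⊕ t) (n ∸ t))))

  geodesicCover : ∀ a → GeodesicCover Cₙ a
  geodesicCover a with h₁ , h₂ , 1+h₁+h₂≡n , h₁+h₁≤n , h₂+h₂≤n ← halves n = record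
    { path₁     = arc a h₁
    ; path₂     = arc (a ⊕ suc h₁) h₂
    ; shortest₁ = arc-shortest a h₁ h₁+h₁≤n
    ; shortest₂ = arc-shortest (a ⊕ suc h₁) h₂ h₂+h₂≤n
    ; a∈path₁   = ∈-arc a z≤n
    ; a∈path₂   = subst (_∈ arc (a ⊕ suc h₁) h₂) around (∈-arc (a ⊕ suc h₁) ≤-refl)
    ; covers    = covers
    }
    where
      around : a ⊕ suc h₁ ⊕ h₂ ≡ a
      around = trans (sym (⊕-+ a (suc h₁) h₂)) (trans (cong (a ⊕_) 1+h₁+h₂≡n) (⊕-n a))
      covers : ∀ x → x ∈ arc a h₁ ⊎ x ∈ arc (a ⊕ suc h₁) h₂
      covers x with t , t<n , x≡a⊕t ← offset a x with t ≤? h₁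
      ... | yes t≤h₁ = inj₁ (subst (_∈ arc a h₁) (sym x≡a⊕t) (∈-arc a t≤h₁))
      ... | no t≰h₁ = inj₂ (subst (_∈ arc (a ⊕ suc h₁) h₂) (sym (trans x≡a⊕t (⊕-∸ a h₁<t)))
                                 (∈-arc (a ⊕ suc h₁) (+-cancelˡ-≤ (suc h₁) (t ∸ suc h₁) h₂ rest≤)))
        where
          h₁<t : h₁ < t
          h₁<t = ≰⇒> t≰h₁
          rest≤ : suc h₁ + (t ∸ suc h₁) ≤ suc h₁ + h₂
          rest≤ = subst₂ _≤_ (sym (m+[n∸m]≡n h₁<t)) (sym 1+h₁+h₂≡n) (<⇒≤ t<n)

  gp⇒AtMostThree : ∀ {S} → InGeneralPosition Cₙ S → AtMostThree S
  gp⇒AtMostThree = geodesicCovers⇒AtMostThree Cₙ geodesicCover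

  gpColouring⇒n≤k*3 : ∀ {k} {c : Fin n → Fin k} → IsGPColouring Cₙ k c → n ≤ k * 3
  gpColouring⇒n≤k*3 {c = c} gp = fibres≤3⇒n≤k*3 n c (λ i → gp⇒AtMostThree (gp i))

  module Residues (k : ℕ) .{{_ : NonZero k}} (k+k<n : k + k < n) (n≤k*3 : n ≤ k * 3) where

    residue : Fin n → Fin k
    residue x = toℕ x mod k

    residue-isGP : IsGPColouring Cₙ k residue
    residue-isGP i p shortest x y z rx ry rz x≢y y≢z x≢z x∈p y∈p z∈p
      with a , m , m≤len , window ← walk-window p
      = let occ₀ , occ₁ , occ₂ = threeDistinct<3⇒012 (quotient<3 x) (quotient<3 y) (quotient<3 z)
              (quotient-injective rx ry x≢y) (quotient-injective ry rz y≢z) (quotient-injective rx rz x≢z)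
              {Occupied (toℕ a) (toℕ i)}
              (occupied rx x∈p) (occupied ry y∈p) (occupied rz z∈p)
        in noThreeOccupied occ₀ occ₁ occ₂
      where
        m+m≤n : m + m ≤ n
        m+m≤n = ≤-trans (+-mono-≤ m≤len m≤len) (shortest-length p shortest)
        open Lifts {n} {k} {m} m+m≤n k+k<n n≤k*3
        quotient : Fin n → ℕ
        quotient w = toℕ w / k
        quotient<3 : ∀ w → quotient w < 3
        quotient<3 w = m<n*o⇒m/o<n (<-≤-trans (toℕ<n w) (subst (n ≤_) (*-comm k 3) n≤k*3))
        decompose : ∀ {w} → residue w ≡ i → toℕ w ≡ toℕ i + quotient w * k
        decompose {w} rw = trans (m≡m%n+[m/n]*n (toℕ w) k)
          (cong (_+ quotient w * k) (trans (sym (toℕ-fromℕ< (m%n<n (toℕ w) k))) (cong toℕ rw)))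
        quotient-injective : ∀ {w w′} → residue w ≡ i → residue w′ ≡ i → w ≢ w′ → quotient w ≢ quotient w′
        quotient-injective rw rw′ w≢w′ q≡q′ = w≢w′ (toℕ-injective
          (trans (decompose rw) (trans (cong (λ q → toℕ i + q * k) q≡q′) (sym (decompose rw′)))))
        occupied : ∀ {w} → residue w ≡ i → w ∈ p → Occupied (toℕ a) (toℕ i) (quotient w)
        occupied {w} rw w∈p with s , s≤m , w≡a⊕s ← window w w∈p =
          toℕ a + s , (m≤m+n (toℕ a) s , +-monoʳ-≤ (toℕ a) s≤m) , lifted (lift-⊕ a (≤-<-trans s≤m (m+m≤n⇒m<n m+m≤n)))
          where
            toℕ-w : toℕ (a ⊕ s) ≡ toℕ i + quotient w * k
            toℕ-w = trans (cong toℕ (sym w≡a⊕s)) (decompose rw)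
            lifted : toℕ a + s ≡ toℕ (a ⊕ s) ⊎ toℕ a + s ≡ toℕ (a ⊕ s) + n → LiftOf (toℕ i) (quotient w) (toℕ a + s)
            lifted (inj₁ e) = inj₁ (trans e toℕ-w)
            lifted (inj₂ e) = inj₂ (trans e (cong (_+ n) toℕ-w))

mainTheorem19 : (n : ℕ) → .{{_ : NonZero n}} → 5 ≤ n →
    GPChromaticNumberIs (Cycle n) ⌈ n /3⌉
mainTheorem19 n 5≤n = (residue , residue-isGP) , λ k c gp → ⌈n/3⌉-least k (gpColouring⇒n≤k*3 gp)
  where
    open CycleGeometry n
    open Residues ⌈ n /3⌉ {{⌈n/3⌉-nonZero}} (⌈n/3⌉+⌈n/3⌉<n 5≤n) (n≤⌈n/3⌉*3 n)
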